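{- Let $G$ be a finite connected graph (multiple edges allowed, no loops) and let $\mathscr{B}$ be a bramble in $G$ of order $k$. Then the scramble order of $\mathscr{B}$ is either $k$ or $k-1$.
   Context: For $A,B\subseteq V(G)$, $E(A,B)$ is the set of edges with one endpoint in $A$ and the other in $B$; $A^c=V(G)\setminus A$. A set $B\subseteq V(G)$ is connected if for every proper subset $A\subsetneq B$ the set $E(A,B\setminus A)$ is nonempty. A scramble is a finite set $\mathscr{S}$ of connected subsets of $V(G)$ (eggs). A bramble is a scramble such that $E\cup E'$ is connected for all $E,E'\in\mathscr{S}$. A hitting set is a set $C\subseteq V(G)$ meeting every egg. The order of a bramble is the minimum size of a hitting set. The scramble order $\|\mathscr{S}\|$ is the maximum integer $k$ such that (1) no $C\subseteq V(G)$ with $|C|<k$ is a hitting set for $\mathscr{S}$, and (2) for every $A\subseteq V(G)$ for which there are eggs $E,E'\in\mathscr{S}$ with $E\subseteq A$ and $E'\subseteq A^c$, one has $|E(A,A^c)|\geq k$. -}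

module Defs where

open import Data.Nat using (ℕ; zero; suc; _+_; _≤_; _<_; _∸_)
open import Data.Bool using (Bool; true; false; _∧_; _∨_; if_then_else_; T)
open import Data.Fin using (Fin)
open import Data.Fin.Subset public
  using (Subset; _∈_; _⊆_; _⊂_; ∁; _∪_; _∩_; _─_; ∣_∣; Nonempty)
open import Data.List using (List; allFin; map)
open import Data.Nat.ListAction using (sum)
open import Data.List.Membership.Propositional using () renaming (_∈_ to _∈ₗ_)
open import Data.Vec using (lookup)
open import Data.Product using (Σ; ∃; _×_; proj₁; proj₂)
open import Data.Sum using (_⊎_)
open import Relation.Binary.PropositionalEquality using (_≡_; _≢_)
open import Relation.Nullary using (¬_)

record Graph : Set where
  field
    n      : ℕ
    m      : ℕ
    ends   : Fin m → Fin n × Fin n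
    noLoop : ∀ e → proj₁ (ends e) ≢ proj₂ (ends e)

module _ (G : Graph) where
  open Graph G

  crosses : Subset n → Subset n → Fin m → Bool
  crosses A B e =
    (lookup A (proj₁ (ends e)) ∧ lookup B (proj₂ (ends e)))
    ∨ (lookup B (proj₁ (ends e)) ∧ lookup A (proj₂ (ends e)))

  edgeCount : Subset n → Subset n → ℕ
  edgeCount A B = sum (map (λ e → if crosses A B e then 1 else 0) (allFin m))

  EdgesNonempty : Subset n → Subset n → Set
  EdgesNonempty A B = ∃ λ (e : Fin m) → T (crosses A B e)

  IsConnected : Subset n → Set
  IsConnected B = ∀ (A : Subset n) → Nonempty A → A ⊂ B → EdgesNonempty A (B ─ A)

  GraphConnected : Set
  GraphConnected = IsConnected (∁ (Data.Fin.Subset.⊥))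

  IsScramble : List (Subset n) → Set
  IsScramble S = ∀ {E} → E ∈ₗ S → IsConnected E

  IsBramble : List (Subset n) → Set
  IsBramble S = IsScramble S × (∀ {E E'} → E ∈ₗ S → E' ∈ₗ S → IsConnected (E ∪ E'))

  IsHittingSet : List (Subset n) → Subset n → Set
  IsHittingSet S C = ∀ {E} → E ∈ₗ S → Nonempty (C ∩ E)

  HasBrambleOrder : List (Subset n) → ℕ → Set
  HasBrambleOrder S k =
    (∃ λ C → IsHittingSet S C × ∣ C ∣ ≡ k)
    × (∀ C → IsHittingSet S C → k ≤ ∣ C ∣)

  ScrambleCond : List (Subset n) → ℕ → Set
  ScrambleCond S k =
    (∀ C → ∣ C ∣ < k → ¬ IsHittingSet S C)
    × (∀ A {E E'} → E ∈ₗ S → E' ∈ₗ S → E ⊆ A → E' ⊆ ∁ A → k ≤ edgeCount A (∁ A))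

  HasScrambleOrder : List (Subset n) → ℕ → Set
  HasScrambleOrder S k = ScrambleCond S k × (∀ j → ScrambleCond S j → j ≤ k)

-- Let A separate eggs E ⊆ A and E' ⊆ Aᶜ.  The bound k ≤ 1 + |E(A,Aᶜ)| comes from a hitting set
-- with one vertex per cut edge plus one more.  Pick an egg G₀ ⊆ A leaving the
-- fewest cut edges from its side, and a cut edge e₀ from G₀ (it exists because
-- G₀ ∪ E' is connected for an egg E' ⊆ Aᶜ).  From each cut edge take its end
-- outside A if its inner end lies in G₀, and its inner end otherwise; add the
-- inner end of e₀.  An egg meeting both sides contains a whole cut edge; an egg
-- F ⊆ Aᶜ is joined to G₀ by a cut edge with inner end in G₀ and outer end in F;
-- an egg F ⊆ A avoiding the inner end of e₀ has a cut edge leaving it from outside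
-- G₀, since otherwise it would leave fewer cut edges than G₀.  Hence
-- ‖B‖ ≥ k - 1, while the hitting set of size k gives ‖B‖ ≤ k.
module Submission where

open import Defs
open import Data.Bool using (Bool; true; false; T; if_then_else_; _∧_)
open import Data.Bool.Properties using (T-∧; T-∨; T-≡)
open import Data.Empty using (⊥-elim)
open import Data.Fin using (Fin)
open import Data.Fin.Subset using (⁅_⁆; _∉_; _⊈_) renaming (⊥ to ∅)
open import Data.Fin.Subset.Properties
  using ( _∈?_; _⊆?_; nonempty?; anySubset?; x∈⁅x⁆; ∣⁅x⁆∣≡1; ∣⊥∣≡0; p⊂q⇒∣p∣<∣q∣
        ; x∈p∩q⁺; x∈p∩q⁻; p∩q⊆p; p∩q⊆q; x∈p∪q⁺; x∈p∪q⁻; p⊆p∪q; q⊆p∪q; p─q⊆p; x∈p∧x∉q⇒x∈p─q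
        ; x∈∁p⇒x∉p; x∉∁p⇒x∈p; x∉p⇒x∈∁p )
open import Data.List using (List; []; _∷_; allFin; map; filter)
open import Data.List.Extrema.Nat using (argmin; argmin-sel; f[argmin]≤f[xs])
open import Data.List.Membership.Propositional using (find; lose) renaming (_∈_ to _∈ₗ_)
open import Data.List.Membership.Propositional.Properties using (∈-allFin; ∈-filter⁺; ∈-filter⁻)
open import Data.List.Relation.Unary.All as All using ()
open import Data.List.Relation.Unary.Any using (Any; here; there) renaming (any? to anyₗ?)
open import Data.Nat using (ℕ; suc; _+_; _∸_; _≤_; _<_; z≤n; s≤s; _<?_)
open import Data.Nat.Properties
open import Data.Nat.ListAction using (sum)
open import Data.Product using (∃; _×_; _,_; proj₁; proj₂)
import Data.Product as Product
open import Data.Sum using (_⊎_; inj₁; inj₂)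
import Data.Sum as Sum
open import Data.Vec using (_∷_; []; lookup; tabulate)
open import Data.Vec.Base using () renaming (here to here[]=; there to there[]=)
open import Data.Vec.Properties using ([]=⇒lookup; lookup⇒[]=; lookup∘tabulate)
open import Function using (Equivalence; _∘_; id)
open import Relation.Nullary using (¬_; does; yes; no)
open import Relation.Nullary.Decidable using (_×-dec_; decidable-stable)
open import Relation.Unary using (Decidable)
open import Relation.Binary.PropositionalEquality using (_≡_; refl; sym; subst; cong)

open Equivalence using (to; from)

∈⇒T-lookup : ∀ {n} {x : Fin n} {p : Subset n} → x ∈ p → T (lookup p x)
∈⇒T-lookup x∈p = T-≡ .from ([]=⇒lookup x∈p)

T-lookup⇒∈ : ∀ {n} {x : Fin n} {p : Subset n} → T (lookup p x) → x ∈ p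
T-lookup⇒∈ t = lookup⇒[]= _ _ (T-≡ .to t)

x∈p─q⇒x∉q : ∀ {n} {x : Fin n} (p q : Subset n) → x ∈ p ─ q → x ∉ q
x∈p─q⇒x∉q (_ ∷ _) (true ∷ _) () here[]=
x∈p─q⇒x∉q (_ ∷ p) (_ ∷ q) (there[]= x∈p─q) (there[]= x∈q) = x∈p─q⇒x∉q p q x∈p─q x∈q

∪-resolveˡ : ∀ {n} {x : Fin n} (p q : Subset n) → x ∈ p ∪ q → x ∉ q → x ∈ p
∪-resolveˡ p q x∈p∪q x∉q = Sum.[ id , ⊥-elim ∘ x∉q ] (x∈p∪q⁻ p q x∈p∪q)

∪-resolveʳ : ∀ {n} {x : Fin n} (p q : Subset n) → x ∈ p ∪ q → x ∉ p → x ∈ q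
∪-resolveʳ p q x∈p∪q x∉p = Sum.[ ⊥-elim ∘ x∉p , id ] (x∈p∪q⁻ p q x∈p∪q)

⊈⇒∃∉ : ∀ {n} {p q : Subset n} → p ⊈ q → ∃ λ x → x ∈ p × x ∉ q
⊈⇒∃∉ {p = p} {q} p⊈q with nonempty? (p ∩ ∁ q)
... | yes (x , x∈p∩∁q) = x , proj₁ (x∈p∩q⁻ p (∁ q) x∈p∩∁q) , x∈∁p⇒x∉p (proj₂ (x∈p∩q⁻ p (∁ q) x∈p∩∁q))
... | no p∩∁q-empty = ⊥-elim (p⊈q λ {x} x∈p → decidable-stable (x ∈? q)
        λ x∉q → p∩∁q-empty (x , x∈p∩q⁺ (x∈p , x∉p⇒x∈∁p x∉q)))

∣p∪q∣≤∣p∣+∣q∣ : ∀ {n} (p q : Subset n) → ∣ p ∪ q ∣ ≤ ∣ p ∣ + ∣ q ∣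
∣p∪q∣≤∣p∣+∣q∣ [] [] = z≤n
∣p∪q∣≤∣p∣+∣q∣ (true ∷ p) (true ∷ q) = s≤s (≤-trans (∣p∪q∣≤∣p∣+∣q∣ p q) (+-monoʳ-≤ ∣ p ∣ (n≤1+n ∣ q ∣)))
∣p∪q∣≤∣p∣+∣q∣ (true ∷ p) (false ∷ q) = s≤s (∣p∪q∣≤∣p∣+∣q∣ p q)
∣p∪q∣≤∣p∣+∣q∣ (false ∷ p) (true ∷ q) rewrite +-suc ∣ p ∣ ∣ q ∣ = s≤s (∣p∪q∣≤∣p∣+∣q∣ p q)
∣p∪q∣≤∣p∣+∣q∣ (false ∷ p) (false ∷ q) = ∣p∪q∣≤∣p∣+∣q∣ p q

module _ {n} {X : Set} (b : X → Bool) (f : X → Fin n) where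

  chosen : List X → Subset n
  chosen [] = ∅
  chosen (x ∷ xs) = if b x then ⁅ f x ⁆ ∪ chosen xs else chosen xs

  ∣chosen∣≤count : ∀ xs → ∣ chosen xs ∣ ≤ sum (map (λ x → if b x then 1 else 0) xs)
  ∣chosen∣≤count [] = ≤-reflexive (∣⊥∣≡0 n)
  ∣chosen∣≤count (x ∷ xs) with b x
  ... | false = ∣chosen∣≤count xs
  ... | true = begin
    ∣ ⁅ f x ⁆ ∪ chosen xs ∣   ≤⟨ ∣p∪q∣≤∣p∣+∣q∣ ⁅ f x ⁆ (chosen xs) ⟩
    ∣ ⁅ f x ⁆ ∣ + ∣ chosen xs ∣ ≡⟨ cong (_+ ∣ chosen xs ∣) (∣⁅x⁆∣≡1 (f x)) ⟩
    suc ∣ chosen xs ∣          ≤⟨ s≤s (∣chosen∣≤count xs) ⟩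
    suc (sum (map (λ x → if b x then 1 else 0) xs)) ∎
    where open ≤-Reasoning

  ∈-chosen : ∀ {x xs} → x ∈ₗ xs → T (b x) → f x ∈ chosen xs
  ∈-chosen {xs = y ∷ xs} (here refl) bx with b y
  ... | true = x∈p∪q⁺ (inj₁ (x∈⁅x⁆ (f y)))
  ∈-chosen {xs = y ∷ xs} (there x∈xs) bx with b y
  ... | true = x∈p∪q⁺ (inj₂ (∈-chosen x∈xs bx))
  ... | false = ∈-chosen x∈xs bx

module _ {X : Set} (μ : X → ℕ) {P : X → Set} (P? : Decidable P) where

  argmin-satisfying : ∀ {x xs} → x ∈ₗ xs → P x →
    ∃ λ x₀ → x₀ ∈ₗ xs × P x₀ × (∀ {y} → y ∈ₗ xs → P y → μ x₀ ≤ μ y)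
  argmin-satisfying {x} {xs} x∈xs Px = x₀ , proj₁ x₀-satisfies , proj₂ x₀-satisfies , x₀-minimal
    where
    x₀ = argmin μ x (filter P? xs)

    x₀-satisfies : x₀ ∈ₗ xs × P x₀
    x₀-satisfies with argmin-sel μ x (filter P? xs)
    ... | inj₁ x₀≡x = subst (λ z → z ∈ₗ xs × P z) (sym x₀≡x) (x∈xs , Px)
    ... | inj₂ x₀∈filter = ∈-filter⁻ P? x₀∈filter

    x₀-minimal : ∀ {y} → y ∈ₗ xs → P y → μ x₀ ≤ μ y
    x₀-minimal y∈xs Py = All.lookup (f[argmin]≤f[xs] {f = μ} x (filter P? xs)) (∈-filter⁺ P? y∈xs Py)

module Edges (G : Graph) where
  open Graph G

  src tgt : Fin m → Fin n
  src e = proj₁ (ends e)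
  tgt e = proj₂ (ends e)

  Joins : Fin m → Subset n → Subset n → Set
  Joins e P Q = (src e ∈ P × tgt e ∈ Q) ⊎ (src e ∈ Q × tgt e ∈ P)

  crosses⇒Joins : ∀ {P Q} e → T (crosses G P Q e) → Joins e P Q
  crosses⇒Joins e t = Sum.map both∈ both∈ (T-∨ .to t)
    where
    both∈ : ∀ {x y P Q} → T (lookup P x ∧ lookup Q y) → x ∈ P × y ∈ Q
    both∈ t = Product.map T-lookup⇒∈ T-lookup⇒∈ (T-∧ .to t)

  Joins⇒crosses : ∀ {P Q} e → Joins e P Q → T (crosses G P Q e)
  Joins⇒crosses e j = T-∨ .from (Sum.map both∈ both∈ j)
    where
    both∈ : ∀ {x y P Q} → x ∈ P × y ∈ Q → T (lookup P x ∧ lookup Q y)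
    both∈ (x∈P , y∈Q) = T-∧ .from (∈⇒T-lookup x∈P , ∈⇒T-lookup y∈Q)

  Joins-mono : ∀ {e P P' Q Q'} → P ⊆ P' → Q ⊆ Q' → Joins e P Q → Joins e P' Q'
  Joins-mono P⊆P' Q⊆Q' = Sum.map (Product.map P⊆P' Q⊆Q') (Product.map Q⊆Q' P⊆P')

module Cut (G : Graph) (A : Subset (Graph.n G)) where
  open Graph G
  open Edges G

  IsCutEdge : Fin m → Set
  IsCutEdge e = T (crosses G A (∁ A) e)

  inner outer : Fin m → Fin n
  inner e = if lookup A (src e) then src e else tgt e
  outer e = if lookup A (src e) then tgt e else src e

  cutEdge-ends : ∀ {e} → IsCutEdge e → inner e ∈ A × outer e ∉ A
  cutEdge-ends {e} cut with lookup A (src e) in src∈?A | crosses⇒Joins e cut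
  ... | true  | inj₁ (_ , tgt∈∁A) = T-lookup⇒∈ (subst T (sym src∈?A) _) , x∈∁p⇒x∉p tgt∈∁A
  ... | true  | inj₂ (src∈∁A , _) = ⊥-elim (x∈∁p⇒x∉p src∈∁A (T-lookup⇒∈ (subst T (sym src∈?A) _)))
  ... | false | inj₁ (src∈A , _) = ⊥-elim (subst T src∈?A (∈⇒T-lookup src∈A))
  ... | false | inj₂ (src∈∁A , tgt∈A) = tgt∈A , x∈∁p⇒x∉p src∈∁A

  Joins⇒inner-outer-∈ : ∀ {e X} → Joins e X X → inner e ∈ X × outer e ∈ X
  Joins⇒inner-outer-∈ {e} j with lookup A (src e) | j
  ... | true  | inj₁ (src∈X , tgt∈X) = src∈X , tgt∈X
  ... | true  | inj₂ (src∈X , tgt∈X) = src∈X , tgt∈X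
  ... | false | inj₁ (src∈X , tgt∈X) = tgt∈X , src∈X
  ... | false | inj₂ (src∈X , tgt∈X) = tgt∈X , src∈X

  connected⇒cutEdge : ∀ {X u w} → IsConnected G X → u ∈ X → u ∈ A → w ∈ X → w ∉ A →
    ∃ λ e → IsCutEdge e × inner e ∈ X × outer e ∈ X
  connected⇒cutEdge {X} {u} {w} X-connected u∈X u∈A w∈X w∉A =
    e , Joins⇒crosses e (Joins-mono (proj₂ ∘ x∈p∩q⁻ X A) rest⊆∁A j)
      , Joins⇒inner-outer-∈ (Joins-mono (p∩q⊆p X A) (p─q⊆p X (X ∩ A)) j)
    where
    X∩A⊂X : X ∩ A ⊂ X
    X∩A⊂X = p∩q⊆p X A , w , w∈X , λ w∈X∩A → w∉A (proj₂ (x∈p∩q⁻ X A w∈X∩A))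

    crossing = X-connected (X ∩ A) (u , x∈p∩q⁺ (u∈X , u∈A)) X∩A⊂X
    e = proj₁ crossing

    j : Joins e (X ∩ A) (X ─ (X ∩ A))
    j = crosses⇒Joins e (proj₂ crossing)

    rest⊆∁A : X ─ (X ∩ A) ⊆ ∁ A
    rest⊆∁A y∈rest = x∉p⇒x∈∁p λ y∈A →
      x∈p─q⇒x∉q X (X ∩ A) y∈rest (x∈p∩q⁺ (p─q⊆p X (X ∩ A) y∈rest , y∈A))

  separated⇒cutEdge : ∀ {F F'} → IsConnected G (F ∪ F') → F ⊆ A → F' ⊆ ∁ A →
    Nonempty F → Nonempty F' → ∃ λ e → IsCutEdge e × inner e ∈ F × outer e ∈ F'
  separated⇒cutEdge {F} {F'} F∪F'-connected F⊆A F'⊆∁A (u , u∈F) (w , w∈F')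
    with connected⇒cutEdge F∪F'-connected (p⊆p∪q F' u∈F) (F⊆A u∈F)
                             (q⊆p∪q F F' w∈F') (x∈∁p⇒x∉p (F'⊆∁A w∈F'))
  ... | e , cut , inner∈F∪F' , outer∈F∪F' with cutEdge-ends cut
  ... | inner∈A , outer∉A =
    e , cut , ∪-resolveˡ F F' inner∈F∪F' (λ inner∈F' → x∈∁p⇒x∉p (F'⊆∁A inner∈F') inner∈A)
            , ∪-resolveʳ F F' outer∈F∪F' (λ outer∈F → outer∉A (F⊆A outer∈F))

  cutEdgesFrom : Subset n → Subset m
  cutEdgesFrom F = tabulate λ e → crosses G A (∁ A) e ∧ lookup F (inner e)

  ∈-cutEdgesFrom⁺ : ∀ {F e} → IsCutEdge e → inner e ∈ F → e ∈ cutEdgesFrom F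
  ∈-cutEdgesFrom⁺ {F} {e} cut inner∈F = T-lookup⇒∈
    (subst T (sym (lookup∘tabulate _ e)) (T-∧ .from (cut , ∈⇒T-lookup inner∈F)))

  ∈-cutEdgesFrom⁻ : ∀ F {e} → e ∈ cutEdgesFrom F → IsCutEdge e × inner e ∈ F
  ∈-cutEdgesFrom⁻ F {e} e∈ = Product.map₂ T-lookup⇒∈
    (T-∧ .to (subst T (lookup∘tabulate _ e) (∈⇒T-lookup e∈)))

module Cover (G : Graph) {B : List (Subset (Graph.n G))} (bramble : IsBramble G B)
  (eggs-nonempty : ∀ {F} → F ∈ₗ B → Nonempty F) (A : Subset (Graph.n G))
  {G₀ E' : Subset (Graph.n G)} (G₀∈B : G₀ ∈ₗ B) (G₀⊆A : G₀ ⊆ A)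
  (G₀-minimal : ∀ {F} → F ∈ₗ B → F ⊆ A → ∣ Cut.cutEdgesFrom G A G₀ ∣ ≤ ∣ Cut.cutEdgesFrom G A F ∣)
  (E'∈B : E' ∈ₗ B) (E'⊆∁A : E' ⊆ ∁ A) where
  open Graph G
  open Cut G A

  joined-to-G₀ : ∀ {F} → F ∈ₗ B → F ⊆ ∁ A → ∃ λ e → IsCutEdge e × inner e ∈ G₀ × outer e ∈ F
  joined-to-G₀ F∈B F⊆∁A = separated⇒cutEdge (proj₂ bramble G₀∈B F∈B) G₀⊆A F⊆∁A
                                             (eggs-nonempty G₀∈B) (eggs-nonempty F∈B)

  e₀ : Fin m
  e₀ = proj₁ (joined-to-G₀ E'∈B E'⊆∁A)

  e₀-cut : IsCutEdge e₀
  e₀-cut = proj₁ (proj₂ (joined-to-G₀ E'∈B E'⊆∁A))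

  inner-e₀∈G₀ : inner e₀ ∈ G₀
  inner-e₀∈G₀ = proj₁ (proj₂ (proj₂ (joined-to-G₀ E'∈B E'⊆∁A)))

  choice : Fin m → Fin n
  choice e = if does (inner e ∈? G₀) then outer e else inner e

  choice≡outer : ∀ {e} → inner e ∈ G₀ → choice e ≡ outer e
  choice≡outer {e} inner∈G₀ with inner e ∈? G₀
  ... | yes _ = refl
  ... | no inner∉G₀ = ⊥-elim (inner∉G₀ inner∈G₀)

  choice≡inner : ∀ {e} → inner e ∉ G₀ → choice e ≡ inner e
  choice≡inner {e} inner∉G₀ with inner e ∈? G₀
  ... | yes inner∈G₀ = ⊥-elim (inner∉G₀ inner∈G₀)
  ... | no _ = refl

  choice-∈ : ∀ {e X} → inner e ∈ X → outer e ∈ X → choice e ∈ X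
  choice-∈ {e} inner∈X outer∈X with inner e ∈? G₀
  ... | yes _ = outer∈X
  ... | no _ = inner∈X

  chosenEnds : Subset n
  chosenEnds = chosen (crosses G A (∁ A)) choice (allFin m)

  cover : Subset n
  cover = ⁅ inner e₀ ⁆ ∪ chosenEnds

  ∣cover∣≤ : ∣ cover ∣ ≤ suc (edgeCount G A (∁ A))
  ∣cover∣≤ = begin
    ∣ cover ∣                           ≤⟨ ∣p∪q∣≤∣p∣+∣q∣ ⁅ inner e₀ ⁆ chosenEnds ⟩
    ∣ ⁅ inner e₀ ⁆ ∣ + ∣ chosenEnds ∣  ≡⟨ cong (_+ ∣ chosenEnds ∣) (∣⁅x⁆∣≡1 (inner e₀)) ⟩
    suc ∣ chosenEnds ∣                 ≤⟨ s≤s (∣chosen∣≤count (crosses G A (∁ A)) choice (allFin m)) ⟩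
    suc (edgeCount G A (∁ A))          ∎
    where open ≤-Reasoning

  choice∈cover : ∀ {e} → IsCutEdge e → choice e ∈ cover
  choice∈cover {e} cut = x∈p∪q⁺ (inj₂ (∈-chosen (crosses G A (∁ A)) choice (∈-allFin e) cut))

  hits : ∀ {x F} → x ∈ cover → x ∈ F → Nonempty (cover ∩ F)
  hits x∈cover x∈F = _ , x∈p∩q⁺ (x∈cover , x∈F)

  cover-hits-straddling : ∀ {F u w} → F ∈ₗ B → u ∈ F → u ∈ A → w ∈ F → w ∉ A → Nonempty (cover ∩ F)
  cover-hits-straddling F∈B u∈F u∈A w∈F w∉A
    with connected⇒cutEdge (proj₁ bramble F∈B) u∈F u∈A w∈F w∉A
  ... | e , cut , inner∈F , outer∈F = hits (choice∈cover cut) (choice-∈ inner∈F outer∈F)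

  cover-hits-outside : ∀ {F} → F ∈ₗ B → F ⊆ ∁ A → Nonempty (cover ∩ F)
  cover-hits-outside {F} F∈B F⊆∁A with joined-to-G₀ F∈B F⊆∁A
  ... | e , cut , inner∈G₀ , outer∈F =
    hits (choice∈cover cut) (subst (_∈ F) (sym (choice≡outer inner∈G₀)) outer∈F)

  cover-hits-inside : ∀ {F} → F ∈ₗ B → F ⊆ A → Nonempty (cover ∩ F)
  cover-hits-inside {F} F∈B F⊆A with inner e₀ ∈? F
  ... | yes inner-e₀∈F = hits (x∈p∪q⁺ (inj₁ (x∈⁅x⁆ (inner e₀)))) inner-e₀∈F
  ... | no inner-e₀∉F with nonempty? (cutEdgesFrom F ─ cutEdgesFrom G₀)
  ...   | yes (e , e∈F─G₀) =
    hits (choice∈cover cut) (subst (_∈ F) (sym (choice≡inner inner∉G₀)) inner∈F)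
    where
    cut : IsCutEdge e
    cut = proj₁ (∈-cutEdgesFrom⁻ F (p─q⊆p (cutEdgesFrom F) (cutEdgesFrom G₀) e∈F─G₀))

    inner∈F : inner e ∈ F
    inner∈F = proj₂ (∈-cutEdgesFrom⁻ F (p─q⊆p (cutEdgesFrom F) (cutEdgesFrom G₀) e∈F─G₀))

    inner∉G₀ : inner e ∉ G₀
    inner∉G₀ inner∈G₀ =
      x∈p─q⇒x∉q (cutEdgesFrom F) (cutEdgesFrom G₀) e∈F─G₀ (∈-cutEdgesFrom⁺ cut inner∈G₀)
  ...   | no F─G₀-empty = ⊥-elim (<⇒≱ fewer-cut-edges (G₀-minimal F∈B F⊆A))
    where
    F⊆G₀ : cutEdgesFrom F ⊆ cutEdgesFrom G₀
    F⊆G₀ {e} e∈F = decidable-stable (e ∈? cutEdgesFrom G₀)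
      λ e∉G₀ → F─G₀-empty (e , x∈p∧x∉q⇒x∈p─q e∈F e∉G₀)

    fewer-cut-edges : ∣ cutEdgesFrom F ∣ < ∣ cutEdgesFrom G₀ ∣
    fewer-cut-edges = p⊂q⇒∣p∣<∣q∣ (F⊆G₀ , e₀ , ∈-cutEdgesFrom⁺ e₀-cut inner-e₀∈G₀
                                   , inner-e₀∉F ∘ proj₂ ∘ ∈-cutEdgesFrom⁻ F)

  cover-hits : IsHittingSet G B cover
  cover-hits {F} F∈B with F ⊆? A
  ... | yes F⊆A = cover-hits-inside F∈B F⊆A
  ... | no F⊈A with F ⊆? ∁ A | ⊈⇒∃∉ F⊈A
  ...   | yes F⊆∁A | _ = cover-hits-outside F∈B F⊆∁A
  ...   | no F⊈∁A | w , w∈F , w∉A with ⊈⇒∃∉ F⊈∁A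
  ...     | u , u∈F , u∉∁A = cover-hits-straddling F∈B u∈F (x∉∁p⇒x∈p u∉∁A) w∈F w∉A

bramble-cut-bound : (G : Graph) {B : List (Subset (Graph.n G))} → IsBramble G B →
  (∀ {F} → F ∈ₗ B → Nonempty F) →
  ∀ {k} → (∀ C → IsHittingSet G B C → k ≤ ∣ C ∣) →
  ∀ A {E E'} → E ∈ₗ B → E' ∈ₗ B → E ⊆ A → E' ⊆ ∁ A → k ≤ suc (edgeCount G A (∁ A))
bramble-cut-bound G {B} bramble eggs-nonempty k-min A E∈B E'∈B E⊆A E'⊆∁A
  with argmin-satisfying (λ F → ∣ Cut.cutEdgesFrom G A F ∣) (_⊆? A) E∈B E⊆A
... | G₀ , G₀∈B , G₀⊆A , G₀-minimal = ≤-trans (k-min cover cover-hits) ∣cover∣≤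
  where open Cover G bramble eggs-nonempty A G₀∈B G₀⊆A G₀-minimal E'∈B E'⊆∁A

hitting-set⇒eggs-nonempty : (G : Graph) {B : List (Subset (Graph.n G))} {C : Subset (Graph.n G)} →
  IsHittingSet G B C → ∀ {F} → F ∈ₗ B → Nonempty F
hitting-set⇒eggs-nonempty G {C = C} C-hits F∈B = Product.map₂ (p∩q⊆q C _) (C-hits F∈B)

SmallSeparation : (G : Graph) → List (Subset (Graph.n G)) → ℕ → Subset (Graph.n G) → Set
SmallSeparation G B k A = Any (_⊆ A) B × Any (_⊆ ∁ A) B × edgeCount G A (∁ A) < k

small-separation? : ∀ G B k → Decidable (SmallSeparation G B k)
small-separation? G B k A =
  anyₗ? (_⊆? A) B ×-dec anyₗ? (_⊆? ∁ A) B ×-dec (edgeCount G A (∁ A) <? k)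

module _ (G : Graph) {B : List (Subset (Graph.n G))} {k : ℕ}
  (k-min : ∀ C → IsHittingSet G B C → k ≤ ∣ C ∣) where

  scrambleOrder-≡ : ∀ {C₀} → IsHittingSet G B C₀ → ∣ C₀ ∣ ≡ k →
    (∀ A → ¬ SmallSeparation G B k A) → HasScrambleOrder G B k
  scrambleOrder-≡ C₀-hits ∣C₀∣≡k no-small-separation =
    ((λ C ∣C∣<k C-hits → <⇒≱ ∣C∣<k (k-min C C-hits)) , cuts-large)
    , λ j (no-small-hitting-set , _) →
        subst (j ≤_) ∣C₀∣≡k (≮⇒≥ λ ∣C₀∣<j → no-small-hitting-set _ ∣C₀∣<j C₀-hits)
    where
    cuts-large : ∀ A {E E'} → E ∈ₗ B → E' ∈ₗ B → E ⊆ A → E' ⊆ ∁ A → k ≤ edgeCount G A (∁ A)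
    cuts-large A E∈B E'∈B E⊆A E'⊆∁A = ≮⇒≥ λ small-cut →
      no-small-separation A (lose E∈B E⊆A , lose E'∈B E'⊆∁A , small-cut)

  scrambleOrder-∸1 :
    (∀ A {E E'} → E ∈ₗ B → E' ∈ₗ B → E ⊆ A → E' ⊆ ∁ A → k ≤ suc (edgeCount G A (∁ A))) →
    ∀ {A} → SmallSeparation G B k A → HasScrambleOrder G B (k ∸ 1)
  scrambleOrder-∸1 cuts-large {A} (some-E⊆A , some-E'⊆∁A , small-cut)
    with find some-E⊆A | find some-E'⊆∁A
  ... | _ , E∈B , E⊆A | _ , E'∈B , E'⊆∁A =
    ( (λ C ∣C∣<k∸1 C-hits → <⇒≱ (<-≤-trans ∣C∣<k∸1 (m∸n≤m k 1)) (k-min C C-hits))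
    , (λ A' F∈B F'∈B F⊆A' F'⊆∁A' → ∸-monoˡ-≤ 1 (cuts-large A' F∈B F'∈B F⊆A' F'⊆∁A')))
    , λ j (_ , cuts-j) → ∸-monoˡ-≤ 1 (≤-<-trans (cuts-j A E∈B E'∈B E⊆A E'⊆∁A) small-cut)

lemma3p6 : (G : Graph) → GraphConnected G →
    (B : List (Subset (Graph.n G))) → IsBramble G B →
    (k : ℕ) → HasBrambleOrder G B k →
    HasScrambleOrder G B k ⊎ HasScrambleOrder G B (k ∸ 1)
lemma3p6 G _ B bramble k ((C₀ , C₀-hits , ∣C₀∣≡k) , k-min)
  with anySubset? (small-separation? G B k)
... | yes (A , small-separation) = inj₂ (scrambleOrder-∸1 G k-min cut-bound small-separation)
  where
  cut-bound = bramble-cut-bound G bramble (hitting-set⇒eggs-nonempty G C₀-hits) k-min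
... | no no-small-separation =
  inj₁ (scrambleOrder-≡ G k-min C₀-hits ∣C₀∣≡k λ A small → no-small-separation (A , small))
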